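{- Let $\mathcal{K}$ be the set of all positions of misère partizan Kayles, i.e. all finite disjunctive sums $S_{n_1}+\cdots+S_{n_r}$ of strips. If $G\in\mathcal{K}$, then the misère outcome of $G$ is not $\mathcal{L}$; that is, there is no position of misère partizan Kayles in which Left wins both when moving first and when moving second.
   Context: Partizan Kayles is played on $1\times n$ strips of squares; $S_n$ denotes an empty strip of length $n$ ($S_0$ is the empty game $0$). On her turn Left places a single square on one empty cell; on his turn Right places a domino covering two adjacent empty cells of the same strip. Placing a piece splits a strip into the (possibly empty) strips of empty cells on either side, so a position is a disjunctive sum of strips $S_n$. Under misère play, a player who cannot move on their turn wins. The misère outcome of a position is $\mathcal{L}$ (Left wins whoever moves first), $\mathcal{R}$ (Right wins whoever moves first), $\mathcal{N}$ (the player moving first wins) or $\mathcal{P}$ (the player moving second wins). -}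

module Defs where

open import Data.Nat using (ℕ; suc; _+_)
open import Data.List using (List; _∷_)
open import Data.Product using (_×_; ∃)
open import Relation.Nullary using (¬_)

-- A position of partizan Kayles: a finite disjunctive sum S_{n1} + ... + S_{nr},
-- represented by the list [n1, ..., nr] of strip lengths.
Position : Set
Position = List ℕ

-- Left places a square on one empty cell of a strip S_{1+a+b}: leaving S_a + S_b.
data LeftMove : Position → Position → Set where
  here  : ∀ a b rest → LeftMove (suc (a + b) ∷ rest) (a ∷ b ∷ rest)
  there : ∀ {n g g'} → LeftMove g g' → LeftMove (n ∷ g) (n ∷ g')

-- Right places a domino on two adjacent empty cells of a strip S_{2+a+b}: leaving S_a + S_b.
data RightMove : Position → Position → Set where
  here  : ∀ a b rest → RightMove (suc (suc (a + b)) ∷ rest) (a ∷ b ∷ rest)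
  there : ∀ {n g g'} → RightMove g g' → RightMove (n ∷ g) (n ∷ g')

-- Misère play: a player who cannot move on their turn wins.
mutual
  data LeftWinsFirst (g : Position) : Set where
    noMove : (∀ g' → ¬ LeftMove g g') → LeftWinsFirst g
    move   : ∀ {g'} → LeftMove g g' → LeftWinsSecond g' → LeftWinsFirst g

  data LeftWinsSecond (g : Position) : Set where
    respond : ∃ (λ g' → RightMove g g') →
              (∀ g' → RightMove g g' → LeftWinsFirst g') → LeftWinsSecond g

OutcomeL : Position → Set
OutcomeL g = LeftWinsFirst g × LeftWinsSecond g

-- Left's moves remove one cell and Right's remove two. A misère win for Left
-- ends with Left unable to move, i.e. on the empty board, so a position Left
-- wins moving first has 0 cells mod 3 and one she wins moving second has
-- 2 cells mod 3.
module Submission where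

open import Defs
open import Relation.Nullary using (¬_)
open import Data.Nat using (ℕ; zero; suc; _+_; NonZero)
open import Data.Nat.DivMod using (_%_; %-distribˡ-+)
open import Data.Nat.Properties using (+-assoc; +-suc)
open import Data.List using ([]; _∷_)
open import Data.Nat.ListAction using (sum)
open import Data.Product using (_,_)
open import Relation.Binary.PropositionalEquality
  using (_≡_; refl; cong; trans; sym; subst)

leftMove-removesOneCell : ∀ {g g'} → LeftMove g g' → sum g ≡ 1 + sum g'
leftMove-removesOneCell (here a b rest) = cong suc (+-assoc a b (sum rest))
leftMove-removesOneCell (there {n} m) =
  trans (cong (n +_) (leftMove-removesOneCell m)) (+-suc n _)

rightMove-removesTwoCells : ∀ {g g'} → RightMove g g' → sum g ≡ 2 + sum g'
rightMove-removesTwoCells (here a b rest) = cong (2 +_) (+-assoc a b (sum rest))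
rightMove-removesTwoCells (there {n} m) =
  trans (cong (n +_) (rightMove-removesTwoCells m))
        (trans (+-suc n _) (cong suc (+-suc n _)))

-- Left can play on any strip of positive length.
noLeftMove⇒sum≡0 : ∀ g → (∀ g' → ¬ LeftMove g g') → sum g ≡ 0
noLeftMove⇒sum≡0 []          _      = refl
noLeftMove⇒sum≡0 (zero ∷ g)  stuck  = noLeftMove⇒sum≡0 g (λ g' m → stuck (zero ∷ g') (there m))
noLeftMove⇒sum≡0 (suc n ∷ g) stuck with () ← stuck _ (here 0 n g)

+-%-congʳ : ∀ k n d {r} .{{_ : NonZero d}} →
            n % d ≡ r → (k + n) % d ≡ ((k % d) + r) % d
+-%-congʳ k n d n%d≡r = subst (λ r → (k + n) % d ≡ (k % d + r) % d) n%d≡r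
                                (%-distribˡ-+ k n d)

mutual
  leftWinsFirst⇒sum%3≡0 : ∀ {g} → LeftWinsFirst g → sum g % 3 ≡ 0
  leftWinsFirst⇒sum%3≡0 {g} (noMove stuck) = cong (_% 3) (noLeftMove⇒sum≡0 g stuck)
  leftWinsFirst⇒sum%3≡0 (move {g'} m w) =
    trans (cong (_% 3) (leftMove-removesOneCell m))
          (+-%-congʳ 1 (sum g') 3 (leftWinsSecond⇒sum%3≡2 w))

  leftWinsSecond⇒sum%3≡2 : ∀ {g} → LeftWinsSecond g → sum g % 3 ≡ 2
  leftWinsSecond⇒sum%3≡2 (respond (g' , m) wins) =
    trans (cong (_% 3) (rightMove-removesTwoCells m))
          (+-%-congʳ 2 (sum g') 3 (leftWinsFirst⇒sum%3≡0 (wins g' m)))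

lemma2p1 : (g : Position) → ¬ OutcomeL g
lemma2p1 g (first , second)
  with () ← trans (sym (leftWinsFirst⇒sum%3≡0 first)) (leftWinsSecond⇒sum%3≡2 second)
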